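{- Let $a,d,h,x$ be positive integers with $\gcd(a,d)=1$ and $1\leq x\leq a-1$, and let $S=\langle a,ha+d,ha+2d,\ldots,ha+xd\rangle$. Let $n=qa+id\in S$, where $q$ and $i$ are integers with $0\leq i<a$. Then $$\max\mathsf{L}(n)=q-\left\lceil\frac{i}{x}\right\rceil(h-1).$$
   Context: $\langle n_0,\ldots,n_x\rangle$ denotes the submonoid $\{\sum_j z_jn_j : z_j\in\mathbb{N}\}$ of $\mathbb{N}=\{0,1,2,\ldots\}$. Write $n_0=a$ and $n_j=ha+jd$ for $1\leq j\leq x$; these are the minimal generators (atoms) of $S$. A factorization of $n\in S$ is a tuple $z=(z_0,\ldots,z_x)\in\mathbb{N}^{x+1}$ with $\sum_j z_jn_j=n$. Its length is $|z|=\sum_j z_j$. The set of lengths of $n$ is $\mathsf{L}(n)=\{|z| : z \text{ a factorization of } n\}$. For a rational $r$, $\lceil r\rceil$ is the least integer $\geq r$. -}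

module Defs where

open import Data.Nat using (ℕ; zero; suc; _+_; _*_; _≤_)
open import Data.Nat.DivMod using (_/_)
open import Data.Fin using (Fin; toℕ)
open import Data.List using (map; allFin)
open import Data.Nat.ListAction using (sum)
open import Data.Product using (Σ; _×_)
open import Relation.Binary.PropositionalEquality using (_≡_)

atom : (a h d x : ℕ) → Fin (suc x) → ℕ
atom a h d x j with toℕ j
... | zero  = a
... | suc k = h * a + suc k * d

Σfin : (k : ℕ) → (Fin k → ℕ) → ℕ
Σfin k f = sum (map f (allFin k))

IsFactorization : (a h d x n : ℕ) → (Fin (suc x) → ℕ) → Set
IsFactorization a h d x n z = Σfin (suc x) (λ j → z j * atom a h d x j) ≡ n

len : (x : ℕ) → (Fin (suc x) → ℕ) → ℕ
len x z = Σfin (suc x) z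

InS : (a h d x n : ℕ) → Set
InS a h d x n = Σ (Fin (suc x) → ℕ) (IsFactorization a h d x n)

IsMaxLength : (a h d x n m : ℕ) → Set
IsMaxLength a h d x n m =
  Σ (Fin (suc x) → ℕ) (λ z → IsFactorization a h d x n z × len x z ≡ m)
  × ((z : Fin (suc x) → ℕ) → IsFactorization a h d x n z → len x z ≤ m)

-- ⌈ i / x ⌉ for x ≥ 1 (the value at x = 0 is irrelevant; set to 0).
ceilDiv : ℕ → ℕ → ℕ
ceilDiv i zero    = 0
ceilDiv i (suc k) = (i + k) / suc k

{-# OPTIONS --safe #-}
-- A factorization with z₀ copies of a and K further atoms, whose indices sum to J, has
-- value (z₀ + hK)a + Jd and length z₀ + K.  Comparing with n = qa + id, coprimality of
-- a and d together with i < a forces i ≤ J and z₀ + hK ≤ q; as J ≤ xK this gives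
-- K ≥ ⌈i/x⌉, so the length (z₀ + hK) − (h − 1)K is at most q − (h − 1)⌈i/x⌉.  Equality
-- is attained by splitting i into ⌈i/x⌉ parts from {1, …, x} and filling up with a's.
module Submission where

open import Defs
open import Data.Nat using (ℕ; zero; suc; _+_; _*_; _∸_; _≤_; _<_; z≤n; s≤s; z<s; _≤?_; NonZero; >-nonZero)
open import Data.Nat.Properties
open import Data.Nat.DivMod using (_%_; m≡m%n+[m/n]*n; m%n<n; m<n*o⇒m/o<n)
open import Data.Nat.Divisibility using (divides; ∣⇒≤)
open import Data.Nat.GCD using (gcd)
open import Data.Nat.Coprimality using (Coprime; coprime-divisor; gcd≡1⇒coprime)
import Data.Nat.ListAction as List
open import Data.Nat.Tactic.RingSolver using (solve-∀)
open import Data.Integer using (ℤ; +_; -[1+_]; -_; _⊖_) renaming (_+_ to _+ℤ_; _*_ to _*ℤ_; _-_ to _-ℤ_)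
open import Data.Integer.Properties using (+-injective; pos-+; pos-*; neg-distribˡ-*; [+m]-[+n]≡m⊖n; ⊖-≥)
import Data.Integer.Tactic.RingSolver as ℤ-Solver
open import Data.Fin using (toℕ; fromℕ; fromℕ<) renaming (zero to fzero; suc to fsuc)
open import Data.Fin.Properties using (toℕ<n; toℕ-fromℕ; toℕ-fromℕ<)
open import Data.List using (tabulate)
open import Data.List.Properties using (map-tabulate)
open import Data.Vec.Functional using (Vector; _∷_; head; tail; updateAt)
open import Algebra.Properties.Semiring.Sum +-*-semiring
  using (sum; sum-syntax; sum-cong-≗; sum-replicate-zero; ∑-distrib-+; *-distribʳ-sum)
open import Data.Product using (Σ; _×_; _,_; proj₂)
open import Data.Empty using (⊥-elim)
open import Function using (_∘_)
open import Relation.Nullary using (yes; no)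
open import Relation.Binary.PropositionalEquality
  using (_≡_; refl; sym; trans; cong; cong₂; subst; module ≡-Reasoning)

Σfin≡sum : ∀ k (f : Vector ℕ k) → Σfin k f ≡ sum f
Σfin≡sum k f = trans (cong List.sum (map-tabulate (λ j → j) f)) (sum-tabulate k f)
  where
  sum-tabulate : ∀ k (f : Vector ℕ k) → List.sum (tabulate f) ≡ sum f
  sum-tabulate zero    f = refl
  sum-tabulate (suc k) f = cong (λ t → f fzero + t) (sum-tabulate k (f ∘ fsuc))

sum-mono-≤ : ∀ {k} {f g : Vector ℕ k} → (∀ j → f j ≤ g j) → sum f ≤ sum g
sum-mono-≤ {zero}  f≤g = z≤n
sum-mono-≤ {suc k} f≤g = +-mono-≤ (f≤g fzero) (sum-mono-≤ (f≤g ∘ fsuc))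

sum-updateAt-suc-* : ∀ {k} (w s : Vector ℕ k) p →
  ∑[ j < k ] (updateAt w p suc j * s j) ≡ ∑[ j < k ] (w j * s j) + s p
sum-updateAt-suc-* {suc k} w s fzero = shift (w fzero) (s fzero) _
  where
  shift : ∀ m n r → suc m * n + r ≡ m * n + r + n
  shift = solve-∀
sum-updateAt-suc-* {suc k} w s (fsuc p) =
  trans (cong (λ t → w fzero * s fzero + t) (sum-updateAt-suc-* (w ∘ fsuc) (s ∘ fsuc) p))
        (sym (+-assoc (w fzero * s fzero) _ _))

partSum : ∀ {k} → Vector ℕ k → ℕ
partSum {k} w = ∑[ j < k ] (w j * suc (toℕ j))

partSum-≤ : ∀ {k} (w : Vector ℕ k) → partSum w ≤ sum w * k
partSum-≤ {k} w = begin
  partSum w               ≤⟨ sum-mono-≤ (λ j → *-monoʳ-≤ (w j) (toℕ<n j)) ⟩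
  ∑[ j < k ] (w j * k)    ≡⟨ sym (*-distribʳ-sum {k} k w) ⟩
  sum w * k               ∎
  where open ≤-Reasoning

-- w j counts the parts equal to j + 1.
Partition : ℕ → ℕ → ℕ → Set
Partition k c i = Σ (Vector ℕ k) λ w → sum w ≡ c × partSum w ≡ i

sum-updateAt-suc : ∀ {k} (w : Vector ℕ k) p → sum (updateAt w p suc) ≡ suc (sum w)
sum-updateAt-suc {suc k} w fzero    = refl
sum-updateAt-suc {suc k} w (fsuc p) =
  trans (cong (λ t → head w + t) (sum-updateAt-suc (tail w) p)) (+-suc (head w) _)

addPart : ∀ {k c r} p → Partition k c r → Partition k (suc c) (r + suc (toℕ p))
addPart p (w , count , total) =
  updateAt w p suc ,
  trans (sum-updateAt-suc w p) (cong suc count) ,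
  trans (sum-updateAt-suc-* w (suc ∘ toℕ) p) (cong (_+ suc (toℕ p)) total)

-- Greedily add a part x, unless the other c parts could then not reach i; in that case
-- the parts are i ∸ c and c ones.
partition-exists : ∀ x' c i → c ≤ i → i ≤ c * suc x' → Partition (suc x') c i
partition-exists x' zero i _ i≤0 =
  (λ _ → 0) , sum-replicate-zero (suc x') , trans (sum-replicate-zero (suc x')) (sym (n≤0⇒n≡0 i≤0))
partition-exists x' (suc c) i 1+c≤i i≤[1+c]x with c + suc x' ≤? i
... | yes c+x≤i = subst (Partition (suc x') (suc c)) total
        (addPart (fromℕ x') (partition-exists x' c (i ∸ suc x') (m+n≤o⇒m≤o∸n c c+x≤i)
                                                 (m≤n+o⇒m∸n≤o i (suc x') i≤[1+c]x)))
  where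
  total : i ∸ suc x' + suc (toℕ (fromℕ x')) ≡ i
  total = trans (cong (λ t → i ∸ suc x' + suc t) (toℕ-fromℕ x')) (m∸n+n≡m (m+n≤o⇒n≤o c c+x≤i))
... | no c+x≰i = subst (Partition (suc x') (suc c)) total
        (addPart (fromℕ< i∸c<x) (partition-exists x' c c ≤-refl (m≤m*n c (suc x'))))
  where
  i∸c<x : i ∸ suc c < suc x'
  i∸c<x = s≤s (m≤n+o⇒m∸n≤o i (suc c) (m≤n⇒m≤1+n (≤-pred (subst (i <_) (+-suc c x') (≰⇒> c+x≰i)))))
  total : c + suc (toℕ (fromℕ< i∸c<x)) ≡ i
  total = trans (cong (λ t → c + suc t) (toℕ-fromℕ< i∸c<x)) (trans (+-suc c _) (m+[n∸m]≡n 1+c≤i))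

ceilDiv-least : ∀ i x' k → i ≤ k * suc x' → ceilDiv i (suc x') ≤ k
ceilDiv-least i x' k i≤kx = ≤-pred (m<n*o⇒m/o<n (begin-strict
  i + x'           ≤⟨ +-monoˡ-≤ x' i≤kx ⟩
  k * suc x' + x'  ≡⟨ +-comm (k * suc x') x' ⟩
  x' + k * suc x'  <⟨ n<1+n _ ⟩
  suc k * suc x'   ∎))
  where open ≤-Reasoning

≤-ceilDiv-* : ∀ i x' → i ≤ ceilDiv i (suc x') * suc x'
≤-ceilDiv-* i x' = +-cancelʳ-≤ x' i _ (begin
  i + x'                             ≡⟨ m≡m%n+[m/n]*n (i + x') (suc x') ⟩
  (i + x') % suc x' + c * suc x'     ≤⟨ +-monoˡ-≤ (c * suc x') (≤-pred (m%n<n (i + x') (suc x'))) ⟩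
  x' + c * suc x'                    ≡⟨ +-comm x' _ ⟩
  c * suc x' + x'                    ∎)
  where
  open ≤-Reasoning
  c = ceilDiv i (suc x')

ceilDiv-≤ : ∀ i x' → ceilDiv i (suc x') ≤ i
ceilDiv-≤ i x' = ceilDiv-least i x' i (m≤m*n i (suc x'))

factorization-value : ∀ a h d x (z : Vector ℕ (suc x)) →
  Σfin (suc x) (λ j → z j * atom a h d x j) ≡ (head z + h * sum (tail z)) * a + partSum (tail z) * d
factorization-value a h d x z = begin
  Σfin (suc x) (λ j → z j * atom a h d x j)
    ≡⟨ Σfin≡sum (suc x) _ ⟩
  z₀ * a + ∑[ j < x ] (w j * (h * a + suc (toℕ j) * d))
    ≡⟨ cong (λ t → z₀ * a + t) (sum-cong-≗ {x} (λ j → *-distribˡ-+ (w j) (h * a) _)) ⟩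
  z₀ * a + ∑[ j < x ] (w j * (h * a) + w j * (suc (toℕ j) * d))
    ≡⟨ cong (λ t → z₀ * a + t) (∑-distrib-+ {x} _ _) ⟩
  z₀ * a + (∑[ j < x ] (w j * (h * a)) + ∑[ j < x ] (w j * (suc (toℕ j) * d)))
    ≡⟨ cong (λ t → z₀ * a + t) (cong₂ _+_ (sym (*-distribʳ-sum {x} (h * a) w))
                                           (sum-cong-≗ {x} (λ j → sym (*-assoc (w j) _ d)))) ⟩
  z₀ * a + (sum w * (h * a) + ∑[ j < x ] (w j * suc (toℕ j) * d))
    ≡⟨ cong (λ t → z₀ * a + (sum w * (h * a) + t)) (sym (*-distribʳ-sum {x} d _)) ⟩
  z₀ * a + (sum w * (h * a) + partSum w * d)
    ≡⟨ regroup z₀ (sum w) (partSum w) h a d ⟩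
  (z₀ + h * sum w) * a + partSum w * d ∎
  where
  open ≡-Reasoning
  z₀ = head z
  w = tail z
  regroup : ∀ z₀ K J h a d → z₀ * a + (K * (h * a) + J * d) ≡ (z₀ + h * K) * a + J * d
  regroup = solve-∀

coprime-cancel : ∀ {a d P J Q i} → Coprime a d → i < a →
                 P * a + J * d ≡ Q * a + i * d → i ≤ J × P ≤ Q
coprime-cancel {a} {d} {P} {J} {Q} {i} coprime i<a eq = i≤J , P≤Q
  where
  instance
    a≢0 : NonZero a
    a≢0 = >-nonZero (≤-<-trans z≤n i<a)

  i≤J : i ≤ J
  i≤J with i ≤? J
  ... | yes i≤J = i≤J
  ... | no i≰J = ⊥-elim (<-irrefl refl (begin-strict
      a      ≤⟨ ∣⇒≤ {{>-nonZero (m<n⇒0<n∸m J<i)}} a∣i∸J ⟩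
      i ∸ J  ≤⟨ m∸n≤m i J ⟩
      i      <⟨ i<a ⟩
      a      ∎))
    where
    open ≤-Reasoning
    J<i = ≰⇒> i≰J
    Pa≡Qa+[i∸J]d : P * a ≡ Q * a + (i ∸ J) * d
    Pa≡Qa+[i∸J]d = +-cancelʳ-≡ (J * d) _ _ (begin-equality
      P * a + J * d                  ≡⟨ eq ⟩
      Q * a + i * d                  ≡⟨ cong (λ t → Q * a + t * d) (sym (m∸n+n≡m (<⇒≤ J<i))) ⟩
      Q * a + (i ∸ J + J) * d        ≡⟨ cong (λ t → Q * a + t) (*-distribʳ-+ d (i ∸ J) J) ⟩
      Q * a + ((i ∸ J) * d + J * d)  ≡⟨ sym (+-assoc (Q * a) _ _) ⟩
      Q * a + (i ∸ J) * d + J * d    ∎)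
    a∣i∸J = coprime-divisor coprime (divides (P ∸ Q) (begin-equality
      d * (i ∸ J)                    ≡⟨ *-comm d (i ∸ J) ⟩
      (i ∸ J) * d                    ≡⟨ sym (m+n∸m≡n (Q * a) _) ⟩
      Q * a + (i ∸ J) * d ∸ Q * a    ≡⟨ cong (_∸ Q * a) (sym Pa≡Qa+[i∸J]d) ⟩
      P * a ∸ Q * a                  ≡⟨ sym (*-distribʳ-∸ a P Q) ⟩
      (P ∸ Q) * a                    ∎))

  P≤Q : P ≤ Q
  P≤Q = *-cancelʳ-≤ P Q a (+-cancelʳ-≤ (J * d) (P * a) (Q * a) (begin
    P * a + J * d  ≡⟨ eq ⟩
    Q * a + i * d  ≤⟨ +-monoʳ-≤ (Q * a) (*-monoˡ-≤ d i≤J) ⟩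
    Q * a + J * d  ∎))
    where open ≤-Reasoning

natural-quotient : ∀ {a d i n P J} (q : ℤ) → Coprime a d → i < a → n ≡ P * a + J * d →
                   + n ≡ q *ℤ + a +ℤ + i *ℤ + d →
                   Σ ℕ λ Q → q ≡ + Q × n ≡ Q * a + i * d × i ≤ J × P ≤ Q
natural-quotient {a} {d} {i} {n} (+ Q) coprime i<a n≡Pa+Jd n≡qa+id =
  Q , refl , n≡Qa+id , coprime-cancel coprime i<a (trans (sym n≡Pa+Jd) n≡Qa+id)
  where
  n≡Qa+id : n ≡ Q * a + i * d
  n≡Qa+id = +-injective (trans n≡qa+id (sym (trans (pos-+ (Q * a) (i * d))
                                                    (cong₂ _+ℤ_ (pos-* Q a) (pos-* i d)))))
natural-quotient {a} {d} {i} {n} {P} {J} -[1+ m ] coprime i<a n≡Pa+Jd n≡qa+id =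
  ⊥-elim (<⇒≱ z<s (proj₂ (coprime-cancel {P = suc m + P} {J} {0} coprime i<a [1+m+P]a+Jd≡id)))
  where
  X = + (suc m * a)
  Y = + i *ℤ + d
  -X≡-[1+m]a : - X ≡ -[1+ m ] *ℤ + a
  -X≡-[1+m]a = trans (cong -_ (pos-* (suc m) a)) (neg-distribˡ-* (+ suc m) (+ a))
  cancel-neg : ∀ (X Y : ℤ) → (- X +ℤ Y) +ℤ X ≡ Y
  cancel-neg = ℤ-Solver.solve-∀
  n+[1+m]a≡id : n + suc m * a ≡ i * d
  n+[1+m]a≡id = +-injective (begin
    + (n + suc m * a)           ≡⟨ pos-+ n (suc m * a) ⟩
    + n +ℤ X                    ≡⟨ cong (_+ℤ X) n≡qa+id ⟩
    -[1+ m ] *ℤ + a +ℤ Y +ℤ X   ≡⟨ cong (λ t → t +ℤ Y +ℤ X) (sym -X≡-[1+m]a) ⟩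
    - X +ℤ Y +ℤ X               ≡⟨ cancel-neg X Y ⟩
    Y                           ≡⟨ sym (pos-* i d) ⟩
    + (i * d)                   ∎)
    where open ≡-Reasoning
  regroup : ∀ m P a J d → (suc m + P) * a + J * d ≡ P * a + J * d + suc m * a
  regroup = solve-∀
  [1+m+P]a+Jd≡id : (suc m + P) * a + J * d ≡ 0 * a + i * d
  [1+m+P]a+Jd≡id = trans (regroup m P a J d) (trans (cong (_+ suc m * a) (sym n≡Pa+Jd)) n+[1+m]a≡id)

m+[1+n]*o≤p⇒m+o≤p∸n*k : ∀ m n o k p → m + suc n * o ≤ p → k ≤ o → m + o ≤ p ∸ n * k
m+[1+n]*o≤p⇒m+o≤p∸n*k m n o k p m+[1+n]o≤p k≤o = m+n≤o⇒m≤o∸n (m + o) (begin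
  m + o + n * k    ≤⟨ +-monoʳ-≤ (m + o) (*-monoʳ-≤ n k≤o) ⟩
  m + o + n * o    ≡⟨ +-assoc m o _ ⟩
  m + suc n * o    ≤⟨ m+[1+n]o≤p ⟩
  p                ∎)
  where open ≤-Reasoning

m∸[1+n]*o+o≡m∸n*o : ∀ m n o → suc n * o ≤ m → m ∸ suc n * o + o ≡ m ∸ n * o
m∸[1+n]*o+o≡m∸n*o m n o [1+n]o≤m = begin
  m ∸ (o + n * o) + o  ≡⟨ cong (λ t → m ∸ t + o) (+-comm o (n * o)) ⟩
  m ∸ (n * o + o) + o  ≡⟨ cong (_+ o) (sym (∸-+-assoc m (n * o) o)) ⟩
  m ∸ n * o ∸ o + o    ≡⟨ m∸n+n≡m (m+n≤o⇒m≤o∸n o [1+n]o≤m) ⟩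
  m ∸ n * o            ∎
  where open ≡-Reasoning

pos-∸-* : ∀ m n o → o * n ≤ m → + (m ∸ o * n) ≡ + m -ℤ + n *ℤ + o
pos-∸-* m n o on≤m = begin
  + (m ∸ o * n)      ≡⟨ sym (⊖-≥ on≤m) ⟩
  m ⊖ o * n          ≡⟨ sym ([+m]-[+n]≡m⊖n m (o * n)) ⟩
  + m -ℤ + (o * n)   ≡⟨ cong (λ t → + m -ℤ t) (trans (cong +_ (*-comm o n)) (pos-* n o)) ⟩
  + m -ℤ + n *ℤ + o  ∎
  where open ≡-Reasoning

factorization-bound : ∀ {a h d x' n i} (q : ℤ) → Coprime a d → i < a → + n ≡ q *ℤ + a +ℤ + i *ℤ + d →
  (z : Vector ℕ (suc (suc x'))) → IsFactorization a h d (suc x') n z →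
  Σ ℕ λ Q → q ≡ + Q × n ≡ Q * a + i * d ×
            head z + h * sum (tail z) ≤ Q × ceilDiv i (suc x') ≤ sum (tail z)
factorization-bound {a} {h} {d} {x'} q coprime i<a n≡qa+id z z-fac
  with natural-quotient q coprime i<a (trans (sym z-fac) (factorization-value a h d (suc x') z)) n≡qa+id
... | Q , q≡Q , n≡Qa+id , i≤J , P≤Q =
  Q , q≡Q , n≡Qa+id , P≤Q , ceilDiv-least _ x' _ (≤-trans i≤J (partSum-≤ (tail z)))

factorization-of-length : ∀ a h' d x' i {n Q} → n ≡ Q * a + i * d → suc h' * ceilDiv i (suc x') ≤ Q →
  Σ (Vector ℕ (suc (suc x'))) λ z →
    IsFactorization a (suc h') d (suc x') n z × len (suc x') z ≡ Q ∸ h' * ceilDiv i (suc x')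
factorization-of-length a h' d x' i {n} {Q} n≡Qa+id hc≤Q
  with partition-exists x' (ceilDiv i (suc x')) i (ceilDiv-≤ i x') (≤-ceilDiv-* i x')
... | w , count , total = z , z-fac , trans (Σfin≡sum (suc (suc x')) z) z-length
  where
  h = suc h'
  c = ceilDiv i (suc x')
  z : Vector ℕ (suc (suc x'))
  z = (Q ∸ h * c) ∷ w
  z-fac : IsFactorization a h d (suc x') n z
  z-fac = begin
    Σfin (suc (suc x')) (λ j → z j * atom a h d (suc x') j)  ≡⟨ factorization-value a h d (suc x') z ⟩
    (Q ∸ h * c + h * sum w) * a + partSum w * d              ≡⟨ cong₂ (λ k t → (Q ∸ h * c + h * k) * a + t * d) count total ⟩
    (Q ∸ h * c + h * c) * a + i * d                          ≡⟨ cong (λ t → t * a + i * d) (m∸n+n≡m hc≤Q) ⟩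
    Q * a + i * d                                            ≡⟨ sym n≡Qa+id ⟩
    n                                                        ∎
    where open ≡-Reasoning
  z-length : Q ∸ h * c + sum w ≡ Q ∸ h' * c
  z-length = trans (cong (λ t → Q ∸ h * c + t) count) (m∸[1+n]*o+o≡m∸n*o Q h' c hc≤Q)

mainTheorem1 : (a d h x : ℕ) → 1 ≤ a → 1 ≤ d → 1 ≤ h → 1 ≤ x → gcd a d ≡ 1 → x ≤ a ∸ 1 →
    (n : ℕ) → InS a h d x n → (q : ℤ) → (i : ℕ) → i < a →
    + n ≡ (q *ℤ + a) +ℤ (+ i *ℤ + d) →
    Σ ℕ (λ m → IsMaxLength a h d x n m × + m ≡ q -ℤ (+ ceilDiv i x *ℤ + (h ∸ 1)))
mainTheorem1 (suc a') d (suc h') (suc x') _ _ _ _ gcd≡1 _ n (z₀ , z₀-fac) q i i<a n≡qa+id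
  with factorization-bound {i = i} q (gcd≡1⇒coprime gcd≡1) i<a n≡qa+id z₀ z₀-fac
... | Q , refl , n≡Qa+id , bound₀ , c≤K₀ =
  Q ∸ h' * c ,
  (factorization-of-length (suc a') h' d x' i n≡Qa+id hc≤Q , longest) ,
  pos-∸-* Q c h' (≤-trans (m≤n+m _ c) hc≤Q)
  where
  c = ceilDiv i (suc x')
  hc≤Q : suc h' * c ≤ Q
  hc≤Q = ≤-trans (*-monoʳ-≤ (suc h') c≤K₀) (≤-trans (m≤n+m _ (head z₀)) bound₀)
  longest : ∀ z → IsFactorization (suc a') (suc h') d (suc x') n z → len (suc x') z ≤ Q ∸ h' * c
  longest z z-fac with factorization-bound {i = i} (+ Q) (gcd≡1⇒coprime gcd≡1) i<a n≡qa+id z z-fac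
  ... | _ , refl , _ , bound , c≤K = begin
    len (suc x') z        ≡⟨ Σfin≡sum (suc (suc x')) z ⟩
    head z + sum (tail z) ≤⟨ m+[1+n]*o≤p⇒m+o≤p∸n*k (head z) h' (sum (tail z)) c Q bound c≤K ⟩
    Q ∸ h' * c            ∎
    where open ≤-Reasoning
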